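{- Let $k\geq 4$ be an integer. If $G$ is a (simple) graph on $3k$ vertices with $e(G)\geq\binom{3k-1}{2}+2$ edges, then $G$ contains $k$ vertex-disjoint triangles.
   Context: All graphs are finite and simple; $e(G)$ denotes the number of edges of $G$. -}

module Defs where

open import Data.Nat using (ℕ)
open import Data.Fin using (Fin; _<_; _<?_)
open import Data.Product using (_×_; _,_; Σ)
open import Data.List using (List; length; filter; allFin; cartesianProduct)
open import Relation.Nullary using (¬_; Dec)
open import Relation.Nullary.Decidable using (_×-dec_)
open import Relation.Binary.PropositionalEquality using (_≡_)

record Graph (n : ℕ) : Set₁ where
  field
    Adj       : Fin n → Fin n → Set
    adj?      : (i j : Fin n) → Dec (Adj i j)
    sym       : ∀ {i j} → Adj i j → Adj j i
    irrefl    : ∀ {i} → ¬ Adj i i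

open Graph public

edgeList : ∀ {n} → Graph n → List (Fin n × Fin n)
edgeList {n} G =
  filter (λ p → (Data.Product.proj₁ p <? Data.Product.proj₂ p)
                ×-dec adj? G (Data.Product.proj₁ p) (Data.Product.proj₂ p))
         (cartesianProduct (allFin n) (allFin n))

e : ∀ {n} → Graph n → ℕ
e G = length (edgeList G)

-- G contains k vertex-disjoint triangles: a map t assigning to each triangle
-- index a ∈ Fin k and corner c ∈ Fin 3 a vertex, injective overall (so the
-- triangles are pairwise vertex-disjoint and each has 3 distinct vertices),
-- with every two corners of the same triangle adjacent.
HasDisjointTriangles : ∀ {n} → Graph n → ℕ → Set
HasDisjointTriangles {n} G k =
  Σ (Fin k → Fin 3 → Fin n) λ t →
    (∀ a b c d → t a c ≡ t b d → (a ≡ b × c ≡ d)) ×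
    (∀ a c d → ¬ c ≡ d → Adj G (t a c) (t a d))

-- Count the non-adjacent pairs (co-edges) instead of the edges: the hypothesis says that the 3k
-- vertices span at most 3k − 3 co-edges, and we prove more generally that 3k vertices spanning at most
-- budget k co-edges contain k disjoint triangles, by induction on k. While the co-edges number at most
-- |S| − 3, every edge v u lies in a triangle, since fewer than |S| − 2 vertices are non-adjacent to v
-- or u. A case analysis on the maximum co-degree yields an edge v u whose co-degrees add up to at
-- least the excess of the co-edges over budget (k − 1); deleting a triangle through it leaves
-- 3(k − 1) vertices with at most budget (k − 1) co-edges.

module Submission where

open import Defs renaming (sym to adj-sym; irrefl to adj-irrefl)
open import Data.Nat using (ℕ; _≤_; _*_; _+_; _∸_)
open import Data.Nat.Combinatorics using (_C_)

open import Data.Fin using (Fin) renaming (zero to fzero; suc to fsuc; _<_ to _<ᶠ_; _<?_ to _<?ᶠ_; _≟_ to _≟ᶠ_)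
import Data.Fin.Properties as Fin
open import Data.List using (List; []; _∷_; [_]; _++_; length; filter; map; cartesianProduct; allFin)
open import Data.List.Extrema.Nat using (argmax; argmax-sel; f[xs]≤f[argmax])
open import Data.List.Membership.Propositional using (_∈_; find; lose)
open import Data.List.Properties using (filter-accept; filter-reject; filter-all; filter-++; length-++; length-tabulate)
open import Data.List.Relation.Binary.Permutation.Propositional as ↭ using (_↭_; ↭-sym; ↭⇒↭ₛ)
open import Data.List.Relation.Binary.Permutation.Propositional.Properties using (↭-length; filter-↭; ∈-resp-↭)
import Data.List.Relation.Binary.Permutation.Setoid.Properties as Permutationₛ
open import Data.List.Relation.Unary.All as All using (All; []; _∷_)
open import Data.List.Relation.Unary.All.Properties using (¬Any⇒All¬)
open import Data.List.Relation.Unary.AllPairs using (AllPairs; []; _∷_)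
open import Data.List.Relation.Unary.AllPairs.Properties using (tabulate⁺-<)
open import Data.List.Relation.Unary.Any using (here; there; any?)
open import Data.List.Relation.Unary.Unique.Propositional using (Unique)
open import Data.List.Relation.Unary.Unique.Propositional.Properties using (allFin⁺)
open import Data.Nat using (zero; suc; _<_; _<?_; z≤n; s≤s; ⌊_/2⌋)
open import Data.Nat.Combinatorics using (nC1≡n; nCk+nC[k+1]≡[n+1]C[k+1])
open import Data.Nat.ListAction using (sum)
open import Data.Nat.Properties
open import Algebra.Properties.CommutativeSemigroup +-commutativeSemigroup using (interchange)
open import Data.Nat.Tactic.RingSolver using (solve-∀)
open import Data.Product using (Σ-syntax; ∃-syntax; _×_; _,_; proj₁; proj₂)
open import Data.Sum using (_⊎_; inj₁; inj₂; [_,_]′)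
open import Function using (id)
open import Level using (0ℓ)
open import Relation.Binary.PropositionalEquality
  using (_≡_; _≢_; refl; sym; trans; cong; cong₂; subst; subst₂; ≢-sym; setoid; module ≡-Reasoning)
open import Relation.Nullary using (¬_; yes; no; ¬?; contradiction)
open import Relation.Nullary.Decidable using (_×-dec_)
open import Relation.Unary using (Pred; Decidable)
open import Relation.Unary.Properties using (∁?)

module _ {A : Set} where

  count : {P : Pred A 0ℓ} → Decidable P → List A → ℕ
  count P? xs = length (filter P? xs)

  module _ {P : Pred A 0ℓ} (P? : Decidable P) where

    count-accept : ∀ {x} xs → P x → count P? (x ∷ xs) ≡ suc (count P? xs)
    count-accept _ p = cong length (filter-accept P? p)

    count-reject : ∀ {x} xs → ¬ P x → count P? (x ∷ xs) ≡ count P? xs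
    count-reject _ ¬p = cong length (filter-reject P? ¬p)

    count-∷ : ∀ x xs → count P? (x ∷ xs) ≡ count P? [ x ] + count P? xs
    count-∷ x xs with P? x
    ... | yes _ = refl
    ... | no _ = refl

    count-↭ : ∀ {xs ys} → xs ↭ ys → count P? xs ≡ count P? ys
    count-↭ xs↭ys = ↭-length (filter-↭ P? xs↭ys)

    count-all : ∀ {xs} → All P xs → count P? xs ≡ length xs
    count-all all = cong length (filter-all P? all)

    count+count-∁ : ∀ xs → count P? xs + count (∁? P?) xs ≡ length xs
    count+count-∁ [] = refl
    count+count-∁ (x ∷ xs) with P? x
    ... | yes _ = cong suc (count+count-∁ xs)
    ... | no _ = trans (+-suc _ _) (cong suc (count+count-∁ xs))

  count-mono : ∀ {P Q : Pred A 0ℓ} (P? : Decidable P) (Q? : Decidable Q) {xs} →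
               (∀ {x} → x ∈ xs → P x → Q x) → count P? xs ≤ count Q? xs
  count-mono P? Q? {[]} P⇒Q = z≤n
  count-mono P? Q? {x ∷ xs} P⇒Q with P? x | Q? x
  ... | yes _ | yes _ = s≤s (count-mono P? Q? λ m → P⇒Q (there m))
  ... | yes p | no ¬q = contradiction (P⇒Q (here refl) p) ¬q
  ... | no _ | yes _ = m≤n⇒m≤1+n (count-mono P? Q? λ m → P⇒Q (there m))
  ... | no _ | no _ = count-mono P? Q? λ m → P⇒Q (there m)

  count-cong : ∀ {P Q : Pred A 0ℓ} (P? : Decidable P) (Q? : Decidable Q) {xs} →
               (∀ {x} → x ∈ xs → P x → Q x) → (∀ {x} → x ∈ xs → Q x → P x) →
               count P? xs ≡ count Q? xs
  count-cong P? Q? P⇒Q Q⇒P = ≤-antisym (count-mono P? Q? P⇒Q) (count-mono Q? P? Q⇒P)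

  length≤count+count : ∀ {P Q : Pred A 0ℓ} (P? : Decidable P) (Q? : Decidable Q) {xs} →
                       All (λ x → P x ⊎ Q x) xs → length xs ≤ count P? xs + count Q? xs
  length≤count+count P? Q? [] = z≤n
  length≤count+count P? Q? {x ∷ xs} (p⊎q ∷ all) with P? x | Q? x
  ... | yes _ | yes _ = s≤s (≤-trans (length≤count+count P? Q? all) (+-monoʳ-≤ _ (n≤1+n _)))
  ... | yes _ | no _ = s≤s (length≤count+count P? Q? all)
  ... | no _ | yes _ = ≤-trans (s≤s (length≤count+count P? Q? all)) (≤-reflexive (sym (+-suc _ _)))
  ... | no ¬p | no ¬q = contradiction p⊎q λ { (inj₁ p) → ¬p p ; (inj₂ q) → ¬q q }

  sum-map-≤ : ∀ (f : A → ℕ) c {xs} → (∀ {x} → x ∈ xs → f x ≤ c) → sum (map f xs) ≤ c * length xs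
  sum-map-≤ f c {[]} bound = z≤n
  sum-map-≤ f c {x ∷ xs} bound =
    ≤-trans (+-mono-≤ (bound (here refl)) (sum-map-≤ f c (λ m → bound (there m))))
            (≤-reflexive (sym (*-suc c (length xs))))

  sum-map-≤-split : ∀ {P : Pred A 0ℓ} (P? : Decidable P) (f : A → ℕ) c e {xs} →
                    (∀ {x} → x ∈ xs → P x → f x ≤ c) → (∀ {x} → x ∈ xs → f x ≤ c + e) →
                    sum (map f xs) ≤ c * length xs + e * count (∁? P?) xs
  sum-map-≤-split P? f c e {[]} _ _ = z≤n
  sum-map-≤-split P? f c e {x ∷ xs} onP everywhere with P? x
  ... | yes p = begin
    f x + sum (map f xs)                          ≤⟨ +-mono-≤ (onP (here refl) p) rest ⟩
    c + (c * length xs + e * count (∁? P?) xs)    ≡⟨ sym (+-assoc c _ _) ⟩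
    c + c * length xs + e * count (∁? P?) xs      ≡⟨ cong (_+ e * count (∁? P?) xs) (sym (*-suc c (length xs))) ⟩
    c * suc (length xs) + e * count (∁? P?) xs    ∎
    where
    open ≤-Reasoning
    rest : sum (map f xs) ≤ c * length xs + e * count (∁? P?) xs
    rest = sum-map-≤-split P? f c e (λ m → onP (there m)) (λ m → everywhere (there m))
  ... | no _ = begin
    f x + sum (map f xs)                            ≤⟨ +-mono-≤ (everywhere (here refl)) rest ⟩
    (c + e) + (c * length xs + e * count (∁? P?) xs) ≡⟨ interchange c e _ _ ⟩
    (c + c * length xs) + (e + e * count (∁? P?) xs) ≡⟨ sym (cong₂ _+_ (*-suc c _) (*-suc e _)) ⟩
    c * suc (length xs) + e * suc (count (∁? P?) xs) ∎
    where
    open ≤-Reasoning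
    rest : sum (map f xs) ≤ c * length xs + e * count (∁? P?) xs
    rest = sum-map-≤-split P? f c e (λ m → onP (there m)) (λ m → everywhere (there m))

  extract : ∀ {x xs} → x ∈ xs → Σ[ ys ∈ List A ] xs ↭ x ∷ ys
  extract (here refl) = _ , ↭.refl
  extract {x} (there {x = y} x∈xs) with extract x∈xs
  ... | ys , xs↭ = y ∷ ys , ↭.trans (↭.prep y xs↭) (↭.swap y x ↭.refl)

  ∈-tail : ∀ {x y : A} {xs} → x ∈ y ∷ xs → x ≢ y → x ∈ xs
  ∈-tail (here x≡y) x≢y = contradiction x≡y x≢y
  ∈-tail (there x∈xs) _ = x∈xs

  extract₂ : ∀ {x y : A} {xs} → x ∈ xs → y ∈ xs → x ≢ y → Σ[ zs ∈ List A ] xs ↭ x ∷ y ∷ zs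
  extract₂ x∈xs y∈xs x≢y with extract x∈xs
  ... | ys , xs↭xys with extract (∈-tail (∈-resp-↭ xs↭xys y∈xs) (≢-sym x≢y))
  ...   | zs , ys↭yzs = zs , ↭.trans xs↭xys (↭.prep _ ys↭yzs)

  extract₃ : ∀ {x y z : A} {xs} → x ∈ xs → y ∈ xs → z ∈ xs → x ≢ y → x ≢ z → y ≢ z →
             Σ[ ws ∈ List A ] xs ↭ x ∷ y ∷ z ∷ ws
  extract₃ x∈xs y∈xs z∈xs x≢y x≢z y≢z with extract₂ x∈xs y∈xs x≢y
  ... | zs , xs↭xyzs with extract (∈-tail (∈-tail (∈-resp-↭ xs↭xyzs z∈xs) (≢-sym x≢z)) (≢-sym y≢z))
  ...   | ws , zs↭zws = ws , ↭.trans xs↭xyzs (↭.prep _ (↭.prep _ zs↭zws))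

  nonEmpty : ∀ {xs : List A} → 0 < length xs → ∃[ x ] x ∈ xs
  nonEmpty {x ∷ _} _ = x , here refl

  unique-↭ : ∀ {xs ys} → xs ↭ ys → Unique xs → Unique ys
  unique-↭ xs↭ys = Permutationₛ.Unique-resp-↭ (setoid A) (↭⇒↭ₛ xs↭ys)

count-cartesianProduct : ∀ {A B : Set} {P : Pred (A × B) 0ℓ} (P? : Decidable P) xs ys →
  count P? (cartesianProduct xs ys) ≡ sum (map (λ x → count (λ y → P? (x , y)) ys) xs)
count-cartesianProduct P? [] ys = refl
count-cartesianProduct P? (x ∷ xs) ys = begin
  length (filter P? (map (x ,_) ys ++ cartesianProduct xs ys))
    ≡⟨ cong length (filter-++ P? (map (x ,_) ys) _) ⟩
  length (filter P? (map (x ,_) ys) ++ filter P? (cartesianProduct xs ys))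
    ≡⟨ length-++ (filter P? (map (x ,_) ys)) ⟩
  count P? (map (x ,_) ys) + count P? (cartesianProduct xs ys)
    ≡⟨ cong₂ _+_ (count-map ys) (count-cartesianProduct P? xs ys) ⟩
  count (λ y → P? (x , y)) ys + sum (map (λ x → count (λ y → P? (x , y)) ys) xs) ∎
  where
  open ≡-Reasoning
  count-map : ∀ zs → count P? (map (x ,_) zs) ≡ count (λ y → P? (x , y)) zs
  count-map [] = refl
  count-map (z ∷ zs) with P? (x , z)
  ... | yes _ = cong suc (count-map zs)
  ... | no _ = count-map zs

m+m≤n⇒m≤⌊n/2⌋ : ∀ {m n} → m + m ≤ n → m ≤ ⌊ n /2⌋
m+m≤n⇒m≤⌊n/2⌋ {m} m+m≤n = subst (_≤ _) (sym (n≡⌊n+n/2⌋ m)) (⌊n/2⌋-mono m+m≤n)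

m+m≤n+n⇒m≤n : ∀ {m n} → m + m ≤ n + n → m ≤ n
m+m≤n+n⇒m≤n {n = n} m+m≤n+n = subst (_ ≤_) (sym (n≡⌊n+n/2⌋ n)) (m+m≤n⇒m≤⌊n/2⌋ m+m≤n+n)

n+nC2≡[1+n]C2 : ∀ m → m + m C 2 ≡ suc m C 2
n+nC2≡[1+n]C2 m = trans (cong (_+ m C 2) (sym (nC1≡n m))) (nCk+nC[k+1]≡[n+1]C[k+1] m 1)

-- From k = 4 on this is 3k − 3; the smaller values are what the heavy-edge case analysis can afford.
budget : ℕ → ℕ
budget 0 = 0
budget 1 = 0
budget 2 = 2
budget 3 = 5
budget (suc (suc (suc (suc m)))) = 9 + 3 * m

budget-tight : ∀ m → budget (4 + m) + 3 ≡ 3 * (4 + m)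
budget-tight = tight
  where
  tight : ∀ m → 9 + 3 * m + 3 ≡ 3 * (4 + m)
  tight = solve-∀

budget-step : ∀ m → budget (5 + m) ≡ budget (4 + m) + 3
budget-step = step
  where
  step : ∀ m → 9 + 3 * (1 + m) ≡ 9 + 3 * m + 3
  step = solve-∀

budget-roomy : ∀ k → budget (suc k) + 3 ≤ 3 * suc k
budget-roomy 0 = ≤-refl
budget-roomy 1 = n≤1+n 5
budget-roomy 2 = n≤1+n 8
budget-roomy (suc (suc (suc m))) = ≤-reflexive (budget-tight m)

≤budget⇒roomy : ∀ k {x} → x ≤ budget (suc k) → x + 3 ≤ 3 * suc k
≤budget⇒roomy k x≤budget = ≤-trans (+-monoˡ-≤ 3 x≤budget) (budget-roomy k)

budget-double : ∀ m → 1 * (3 * (5 + m)) ≤ budget (4 + m) + budget (4 + m)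
budget-double m = subst (1 * (3 * (5 + m)) ≤_) (sum≡ m) (m≤m+n _ (3 + 3 * m))
  where
  sum≡ : ∀ m → 1 * (3 * (5 + m)) + (3 + 3 * m) ≡ (9 + 3 * m) + (9 + 3 * m)
  sum≡ = solve-∀

module _ {n : ℕ} (G : Graph n) where

  private
    V = Fin n

  adj⇒≢ : ∀ {x y} → Adj G x y → x ≢ y
  adj⇒≢ {x} xy refl = adj-irrefl G xy

  CoAdj : V → V → Set
  CoAdj x y = x ≢ y × ¬ Adj G x y

  coAdj? : (x : V) → Decidable (CoAdj x)
  coAdj? x y = ¬? (x ≟ᶠ y) ×-dec ¬? (adj? G x y)

  coDegree : List V → V → ℕ
  coDegree S x = count (coAdj? x) S

  coEdges : List V → ℕ
  coEdges [] = 0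
  coEdges (x ∷ xs) = coDegree xs x + coEdges xs

  coDegree-skip : ∀ {x y} ys → ¬ CoAdj x y → coDegree (y ∷ ys) x ≡ coDegree ys x
  coDegree-skip ys = count-reject (coAdj? _) ys

  coDegree-self : ∀ x ys → coDegree (x ∷ ys) x ≡ coDegree ys x
  coDegree-self x ys = coDegree-skip ys λ (x≢x , _) → x≢x refl

  coDegree-adj : ∀ {x y} ys → Adj G x y → coDegree (y ∷ ys) x ≡ coDegree ys x
  coDegree-adj ys xy = coDegree-skip ys λ (_ , ¬xy) → ¬xy xy

  coAdj-sym : ∀ {x y} → CoAdj x y → CoAdj y x
  coAdj-sym (x≢y , ¬xy) = (λ y≡x → x≢y (sym y≡x)) , λ yx → ¬xy (adj-sym G yx)

  coDegree-single : ∀ x y → coDegree [ y ] x ≡ coDegree [ x ] y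
  coDegree-single x y with coAdj? x y
  ... | yes xy = trans (count-accept (coAdj? x) [] xy) (sym (count-accept (coAdj? y) [] (coAdj-sym xy)))
  ... | no ¬xy = trans (count-reject (coAdj? x) [] ¬xy) (sym (count-reject (coAdj? y) [] λ yx → ¬xy (coAdj-sym yx)))

  coEdges-↭ : ∀ {xs ys} → xs ↭ ys → coEdges xs ≡ coEdges ys
  coEdges-↭ ↭.refl = refl
  coEdges-↭ (↭.prep x xs↭ys) = cong₂ _+_ (count-↭ (coAdj? x) xs↭ys) (coEdges-↭ xs↭ys)
  coEdges-↭ (↭.trans xs↭ys ys↭zs) = trans (coEdges-↭ xs↭ys) (coEdges-↭ ys↭zs)
  coEdges-↭ {x ∷ y ∷ xs} {.y ∷ .x ∷ ys} (↭.swap x y xs↭ys) = begin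
    coDegree (y ∷ xs) x + (coDegree xs y + coEdges xs)
      ≡⟨ cong₂ _+_ (count-∷ (coAdj? x) y xs) (cong₂ _+_ (count-↭ (coAdj? y) xs↭ys) (coEdges-↭ xs↭ys)) ⟩
    (coDegree [ y ] x + coDegree xs x) + (coDegree ys y + coEdges ys)
      ≡⟨ interchange (coDegree [ y ] x) (coDegree xs x) (coDegree ys y) (coEdges ys) ⟩
    (coDegree [ y ] x + coDegree ys y) + (coDegree xs x + coEdges ys)
      ≡⟨ cong₂ (λ a b → (a + coDegree ys y) + (b + coEdges ys)) (coDegree-single x y) (count-↭ (coAdj? x) xs↭ys) ⟩
    (coDegree [ x ] y + coDegree ys y) + (coDegree ys x + coEdges ys)
      ≡⟨ cong (_+ _) (sym (count-∷ (coAdj? y) x ys)) ⟩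
    coDegree (x ∷ ys) y + (coDegree ys x + coEdges ys) ∎
    where open ≡-Reasoning

  handshake : ∀ S → sum (map (coDegree S) S) ≡ coEdges S + coEdges S
  handshake [] = refl
  handshake (x ∷ xs) = begin
    coDegree (x ∷ xs) x + sum (map (coDegree (x ∷ xs)) xs)
      ≡⟨ cong₂ _+_ (coDegree-self x xs) (sum-coDegree-∷ xs) ⟩
    coDegree xs x + (coDegree xs x + sum (map (coDegree xs) xs))
      ≡⟨ cong (λ s → coDegree xs x + (coDegree xs x + s)) (handshake xs) ⟩
    coDegree xs x + (coDegree xs x + (coEdges xs + coEdges xs))
      ≡⟨ sym (+-assoc (coDegree xs x) _ _) ⟩
    (coDegree xs x + coDegree xs x) + (coEdges xs + coEdges xs)
      ≡⟨ interchange (coDegree xs x) _ _ _ ⟩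
    coEdges (x ∷ xs) + coEdges (x ∷ xs) ∎
    where
    open ≡-Reasoning
    sum-coDegree-∷ : ∀ L → sum (map (coDegree (x ∷ xs)) L) ≡ coDegree L x + sum (map (coDegree xs) L)
    sum-coDegree-∷ [] = refl
    sum-coDegree-∷ (y ∷ L) = begin
      coDegree (x ∷ xs) y + sum (map (coDegree (x ∷ xs)) L)
        ≡⟨ cong₂ _+_ (count-∷ (coAdj? y) x xs) (sum-coDegree-∷ L) ⟩
      (coDegree [ x ] y + coDegree xs y) + (coDegree L x + sum (map (coDegree xs) L))
        ≡⟨ interchange (coDegree [ x ] y) _ _ _ ⟩
      (coDegree [ x ] y + coDegree L x) + (coDegree xs y + sum (map (coDegree xs) L))
        ≡⟨ cong (λ a → (a + coDegree L x) + _) (coDegree-single y x) ⟩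
      (coDegree [ y ] x + coDegree L x) + (coDegree xs y + sum (map (coDegree xs) L))
        ≡⟨ cong (_+ _) (sym (count-∷ (coAdj? x) y L)) ⟩
      coDegree (y ∷ L) x + (coDegree xs y + sum (map (coDegree xs) L)) ∎

  coDegree≤coEdges : ∀ {v} {S : List V} → v ∈ S → coDegree S v ≤ coEdges S
  coDegree≤coEdges {v} {S} v∈S with extract v∈S
  ... | R , S↭vR = begin
    coDegree S v       ≡⟨ count-↭ (coAdj? v) S↭vR ⟩
    coDegree (v ∷ R) v ≡⟨ coDegree-self v R ⟩
    coDegree R v       ≤⟨ m≤m+n _ _ ⟩
    coEdges (v ∷ R)    ≡⟨ sym (coEdges-↭ S↭vR) ⟩
    coEdges S          ∎
    where open ≤-Reasoning

  nonNeighbours≤ : ∀ {v} {S : List V} → Unique S → v ∈ S → count (∁? (adj? G v)) S ≤ suc (coDegree S v)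
  nonNeighbours≤ {v} {S} unique v∈S with extract v∈S
  ... | R , S↭vR with unique-↭ S↭vR unique
  ...   | v∉R ∷ _ = begin
    count (∁? (adj? G v)) S       ≡⟨ count-↭ (∁? (adj? G v)) S↭vR ⟩
    count (∁? (adj? G v)) (v ∷ R) ≡⟨ count-accept (∁? (adj? G v)) R (adj-irrefl G) ⟩
    suc (count (∁? (adj? G v)) R) ≤⟨ s≤s (count-mono (∁? (adj? G v)) (coAdj? v) λ y∈R ¬vy →
                                                                  All.lookup v∉R y∈R , ¬vy) ⟩
    suc (coDegree R v)            ≡⟨ cong suc (sym (trans (count-↭ (coAdj? v) S↭vR) (coDegree-self v R))) ⟩
    suc (coDegree S v)            ∎
    where open ≤-Reasoning

  coDegrees-split : ∀ {S : List V} {v u R} → S ↭ v ∷ u ∷ R → Adj G v u →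
                    coDegree S v + coDegree S u ≡ coDegree R v + coDegree R u
  coDegrees-split {S} {v} {u} {R} S↭vuR vu = cong₂ _+_
    (trans (count-↭ (coAdj? v) S↭vuR) (trans (coDegree-self v (u ∷ R)) (coDegree-adj R vu)))
    (trans (count-↭ (coAdj? u) S↭vuR) (trans (coDegree-adj (u ∷ R) (adj-sym G vu)) (coDegree-self u R)))

  -- Since v u is an edge, no co-edge is counted in both co-degrees.
  coEdges-split : ∀ {S : List V} {v u R} → S ↭ v ∷ u ∷ R → Adj G v u →
                  coEdges S ≡ (coDegree S v + coDegree S u) + coEdges R
  coEdges-split {S} {v} {u} {R} S↭vuR vu = begin
    coEdges S                                       ≡⟨ coEdges-↭ S↭vuR ⟩
    coDegree (u ∷ R) v + (coDegree R u + coEdges R) ≡⟨ cong (_+ _) (coDegree-adj R vu) ⟩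
    coDegree R v + (coDegree R u + coEdges R)       ≡⟨ sym (+-assoc (coDegree R v) _ _) ⟩
    (coDegree R v + coDegree R u) + coEdges R       ≡⟨ cong (_+ coEdges R) (coDegrees-split S↭vuR vu) ⟨
    (coDegree S v + coDegree S u) + coEdges R       ∎
    where open ≡-Reasoning

  upper? : (x : V) → Decidable (λ y → x <ᶠ y × Adj G x y)
  upper? x y = (x <?ᶠ y) ×-dec adj? G x y

  upperDegree : List V → V → ℕ
  upperDegree L x = count (upper? x) L

  sum-upperDegree+coEdges : ∀ {L} → AllPairs _<ᶠ_ L → sum (map (upperDegree L) L) + coEdges L ≡ length L C 2
  sum-upperDegree+coEdges [] = refl
  sum-upperDegree+coEdges {x ∷ L} (x<L ∷ sorted) = begin
    (upperDegree (x ∷ L) x + sum (map (upperDegree (x ∷ L)) L)) + (coDegree L x + coEdges L)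
      ≡⟨ cong (λ a → (a + sum (map (upperDegree (x ∷ L)) L)) + (coDegree L x + coEdges L)) upperDegree-least ⟩
    (count (adj? G x) L + sum (map (upperDegree (x ∷ L)) L)) + (coDegree L x + coEdges L)
      ≡⟨ cong (λ s → (count (adj? G x) L + s) + (coDegree L x + coEdges L)) (sum-upperDegree-later x<L) ⟩
    (count (adj? G x) L + sum (map (upperDegree L) L)) + (coDegree L x + coEdges L)
      ≡⟨ interchange (count (adj? G x) L) _ _ _ ⟩
    (count (adj? G x) L + coDegree L x) + (sum (map (upperDegree L) L) + coEdges L)
      ≡⟨ cong₂ _+_ degree+coDegree (sum-upperDegree+coEdges sorted) ⟩
    length L + length L C 2
      ≡⟨ n+nC2≡[1+n]C2 (length L) ⟩
    suc (length L) C 2 ∎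
    where
    open ≡-Reasoning
    upperDegree-least : upperDegree (x ∷ L) x ≡ count (adj? G x) L
    upperDegree-least = trans (count-reject (upper? x) L λ (x<x , _) → Fin.<-irrefl refl x<x)
      (count-cong (upper? x) (adj? G x) (λ _ (_ , xy) → xy) (λ y∈L xy → All.lookup x<L y∈L , xy))
    degree+coDegree : count (adj? G x) L + coDegree L x ≡ length L
    degree+coDegree = trans (cong (count (adj? G x) L +_) (count-cong (coAdj? x) (∁? (adj? G x)) (λ _ (_ , ¬xy) → ¬xy)
        (λ y∈L ¬xy → (λ x≡y → Fin.<-irrefl x≡y (All.lookup x<L y∈L)) , ¬xy)))
      (count+count-∁ (adj? G x) L)
    sum-upperDegree-later : ∀ {M} → All (x <ᶠ_) M → sum (map (upperDegree (x ∷ L)) M) ≡ sum (map (upperDegree L) M)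
    sum-upperDegree-later [] = refl
    sum-upperDegree-later (x<y ∷ x<M) = cong₂ _+_
      (count-reject (upper? _) L λ (y<x , _) → Fin.<-asym x<y y<x) (sum-upperDegree-later x<M)

  e+coEdges≡C2 : e G + coEdges (allFin n) ≡ n C 2
  e+coEdges≡C2 = begin
    e G + coEdges (allFin n)
      ≡⟨ cong (_+ coEdges (allFin n)) (count-cartesianProduct (λ p → upper? (proj₁ p) (proj₂ p)) (allFin n) (allFin n)) ⟩
    sum (map (upperDegree (allFin n)) (allFin n)) + coEdges (allFin n)
      ≡⟨ sum-upperDegree+coEdges (tabulate⁺-< λ i<j → i<j) ⟩
    length (allFin n) C 2
      ≡⟨ cong (_C 2) (length-tabulate {n = n} id) ⟩
    n C 2 ∎
    where open ≡-Reasoning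

  MaxCoDegree : List V → ℕ → Set
  MaxCoDegree S c = ∀ {y} → y ∈ S → coDegree S y ≤ c

  record HeavyEdge (S : List V) (t : ℕ) : Set where
    constructor heavyEdge
    field
      {v u}    : V
      v∈S      : v ∈ S
      u∈S      : u ∈ S
      adjacent : Adj G v u
      heavy    : coEdges S ≤ t + (coDegree S v + coDegree S u)

  module Dense {S : List V} (unique : Unique S) {size : ℕ} (|S| : length S ≡ size)
               (roomy : coEdges S + 3 ≤ size) where

    overfull : ¬ length S ≤ 2 + coEdges S
    overfull S≤ = 1+n≰n (+-cancelʳ-≤ (coEdges S) 3 2
      (≤-trans (≤-reflexive (+-comm 3 (coEdges S))) (≤-trans roomy (subst (_≤ 2 + coEdges S) |S| S≤))))

    neighbour : ∀ {v} → v ∈ S → ∃[ u ] u ∈ S × Adj G v u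
    neighbour {v} v∈S with any? (adj? G v) S
    ... | yes found = find found
    ... | no none = contradiction (begin
      length S                      ≡⟨ count-all (∁? (adj? G v)) (¬Any⇒All¬ S none) ⟨
      count (∁? (adj? G v)) S       ≤⟨ nonNeighbours≤ unique v∈S ⟩
      suc (coDegree S v)            ≤⟨ s≤s (coDegree≤coEdges v∈S) ⟩
      suc (coEdges S)               ≤⟨ n≤1+n _ ⟩
      2 + coEdges S                 ∎) overfull
      where open ≤-Reasoning

    commonNeighbour : ∀ {v u} → v ∈ S → u ∈ S → Adj G v u → ∃[ w ] w ∈ S × Adj G v w × Adj G u w
    commonNeighbour {v} {u} v∈S u∈S vu with extract₂ v∈S u∈S (adj⇒≢ vu)
    ... | R , S↭vuR with any? (λ w → adj? G v w ×-dec adj? G u w) R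
    ...   | yes found = let w , w∈R , vw , uw = find found
                        in w , ∈-resp-↭ (↭-sym S↭vuR) (there (there w∈R)) , vw , uw
    ...   | no none = contradiction (begin
      length S
        ≡⟨ ↭-length S↭vuR ⟩
      2 + length R
        ≤⟨ +-monoʳ-≤ 2 (length≤count+count (coAdj? v) (coAdj? u) (All.tabulate coAdj-either)) ⟩
      2 + (coDegree R v + coDegree R u)
        ≡⟨ cong (2 +_) (coDegrees-split S↭vuR vu) ⟨
      2 + (coDegree S v + coDegree S u)
        ≤⟨ +-monoʳ-≤ 2 (m≤m+n _ (coEdges R)) ⟩
      2 + ((coDegree S v + coDegree S u) + coEdges R)
        ≡⟨ cong (2 +_) (coEdges-split S↭vuR vu) ⟨
      2 + coEdges S ∎) overfull
      where
      open ≤-Reasoning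
      coAdj-either : ∀ {y} → y ∈ R → CoAdj v y ⊎ CoAdj u y
      coAdj-either {y} y∈R with unique-↭ S↭vuR unique | adj? G v y
      ... | v∉uR ∷ _ | no ¬vy = inj₁ (All.lookup v∉uR (there y∈R) , ¬vy)
      ... | _ ∷ u∉R ∷ _ | yes vy = inj₂ (All.lookup u∉R y∈R , λ uy → none (lose y∈R (vy , uy)))

    maxCoDegreeVertex : ∃[ v ] v ∈ S × MaxCoDegree S (coDegree S v)
    maxCoDegreeVertex with nonEmpty {xs = S} (≤-trans (s≤s z≤n) (≤-trans (m≤n+m 3 (coEdges S)) (subst (_ ≤_) (sym |S|) roomy)))
    ... | v₀ , v₀∈S = argmax (coDegree S) v₀ S
                    , [ (λ max≡v₀ → subst (_∈ S) (sym max≡v₀) v₀∈S) , id ]′ (argmax-sel (coDegree S) v₀ S)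
                    , All.lookup (f[xs]≤f[argmax] {f = coDegree S} v₀ S)

    byMaxCoDegree : {B : Set} → (∀ {v} D → v ∈ S → D ≤ coDegree S v → MaxCoDegree S D → B) → B
    byMaxCoDegree k = let v , v∈S , max = maxCoDegreeVertex in k (coDegree S v) v∈S ≤-refl max

    sparse : ∀ {c} → MaxCoDegree S c → coEdges S + coEdges S ≤ c * size
    sparse {c} max = subst₂ _≤_ (handshake S) (cong (c *_) |S|) (sum-map-≤ (coDegree S) c max)

    -- If no neighbour of v has co-degree above c, the neighbours contribute at most c and the at most
    -- 1 + (c + e) non-neighbours at most c + e to the handshake sum.
    heavyNeighbourOrSparse : ∀ {v} → v ∈ S → ∀ c e → MaxCoDegree S (c + e) →
      (∃[ u ] u ∈ S × Adj G v u × c < coDegree S u) ⊎ (coEdges S + coEdges S ≤ c * size + e * suc (c + e))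
    heavyNeighbourOrSparse {v} v∈S c e max with any? (λ u → adj? G v u ×-dec c <? coDegree S u) S
    ... | yes found = inj₁ (let u , u∈S , vu , c<du = find found in u , u∈S , vu , c<du)
    ... | no none = inj₂ (begin
      coEdges S + coEdges S
        ≡⟨ handshake S ⟨
      sum (map (coDegree S) S)
        ≤⟨ sum-map-≤-split (adj? G v) (coDegree S) c e
             (λ u∈S vu → ≮⇒≥ λ c<du → none (lose u∈S (vu , c<du))) max ⟩
      c * length S + e * count (∁? (adj? G v)) S
        ≤⟨ +-mono-≤ (≤-reflexive (cong (c *_) |S|))
                    (*-monoʳ-≤ e (≤-trans (nonNeighbours≤ unique v∈S) (s≤s (max v∈S)))) ⟩
      c * size + e * suc (c + e) ∎)
      where open ≤-Reasoning

    heavyEdgeAt : ∀ {v t} → v ∈ S → coEdges S ≤ t + coDegree S v → HeavyEdge S t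
    heavyEdgeAt {t = t} v∈S light with neighbour v∈S
    ... | u , u∈S , vu = heavyEdge v∈S u∈S vu (≤-trans light (+-monoʳ-≤ t (m≤m+n _ _)))

    heavyEdgeAnywhere : ∀ {t} → coEdges S ≤ t → HeavyEdge S t
    heavyEdgeAnywhere {t} light = byMaxCoDegree λ _ v∈S _ _ → heavyEdgeAt v∈S (≤-trans light (m≤m+n t _))

  -- Split on the maximum co-degree D of S: for large D its vertex is heavy with any neighbour;
  -- otherwise it has a neighbour of large co-degree, or the handshake lemma makes coEdges S small.
  module _ {S : List V} (unique : Unique S) where

    heavyEdge₆ : length S ≡ 6 → coEdges S ≤ 2 → HeavyEdge S 0
    heavyEdge₆ |S| hN = byMaxCoDegree go
      where
      open Dense unique |S| (≤budget⇒roomy 1 hN)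
      go : ∀ {v} D → v ∈ S → D ≤ coDegree S v → MaxCoDegree S D → HeavyEdge S 0
      go (suc (suc _)) v∈S D≤dv _ = heavyEdgeAt v∈S (≤-trans hN (≤-trans (m≤m+n 2 _) D≤dv))
      go 1 v∈S 1≤dv max with heavyNeighbourOrSparse v∈S 0 1 max
      ... | inj₁ (u , u∈S , vu , 1≤du) = heavyEdge v∈S u∈S vu (≤-trans hN (+-mono-≤ 1≤dv 1≤du))
      ... | inj₂ sparse₁ = heavyEdgeAt v∈S (≤-trans (m+m≤n⇒m≤⌊n/2⌋ sparse₁) 1≤dv)
      go 0 _ _ max = heavyEdgeAnywhere (m+m≤n⇒m≤⌊n/2⌋ (sparse max))

    heavyEdge₉ : length S ≡ 9 → coEdges S ≤ 5 → HeavyEdge S 2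
    heavyEdge₉ |S| hN = byMaxCoDegree go
      where
      open Dense unique |S| (≤budget⇒roomy 2 hN)
      go : ∀ {v} D → v ∈ S → D ≤ coDegree S v → MaxCoDegree S D → HeavyEdge S 2
      go (suc (suc (suc _))) v∈S D≤dv _ =
          heavyEdgeAt v∈S (≤-trans hN (+-monoʳ-≤ 2 (≤-trans (m≤m+n 3 _) D≤dv)))
      go 2 v∈S 2≤dv max with heavyNeighbourOrSparse v∈S 0 2 max
      ... | inj₁ (u , u∈S , vu , 1≤du) =
          heavyEdge v∈S u∈S vu (≤-trans hN (+-monoʳ-≤ 2 (+-mono-≤ 2≤dv 1≤du)))
      ... | inj₂ sparse₂ =
          heavyEdgeAt v∈S (≤-trans (m+m≤n⇒m≤⌊n/2⌋ sparse₂) (≤-trans (n≤1+n 3) (+-monoʳ-≤ 2 2≤dv)))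
      go 1 v∈S 1≤dv max with heavyNeighbourOrSparse v∈S 0 1 max
      ... | inj₁ (u , u∈S , vu , 1≤du) =
          heavyEdge v∈S u∈S vu (≤-trans (m+m≤n⇒m≤⌊n/2⌋ (sparse max)) (+-monoʳ-≤ 2 (+-mono-≤ 1≤dv 1≤du)))
      ... | inj₂ sparse₁ = heavyEdgeAnywhere (≤-trans (m+m≤n⇒m≤⌊n/2⌋ sparse₁) (n≤1+n 1))
      go 0 _ _ max = heavyEdgeAnywhere (≤-trans (m+m≤n⇒m≤⌊n/2⌋ (sparse max)) z≤n)

    heavyEdge₁₂ : length S ≡ 12 → coEdges S ≤ 9 → HeavyEdge S 5
    heavyEdge₁₂ |S| hN = byMaxCoDegree go
      where
      open Dense unique |S| (≤budget⇒roomy 3 hN)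
      go : ∀ {v} D → v ∈ S → D ≤ coDegree S v → MaxCoDegree S D → HeavyEdge S 5
      go (suc (suc (suc (suc _)))) v∈S D≤dv _ =
          heavyEdgeAt v∈S (≤-trans hN (+-monoʳ-≤ 5 (≤-trans (m≤m+n 4 _) D≤dv)))
      go 3 v∈S 3≤dv max with heavyNeighbourOrSparse v∈S 0 3 max
      ... | inj₁ (u , u∈S , vu , 1≤du) =
          heavyEdge v∈S u∈S vu (≤-trans hN (+-monoʳ-≤ 5 (+-mono-≤ 3≤dv 1≤du)))
      ... | inj₂ sparse₃ =
          heavyEdgeAt v∈S (≤-trans (m+m≤n⇒m≤⌊n/2⌋ sparse₃) (≤-trans (m≤m+n 6 2) (+-monoʳ-≤ 5 3≤dv)))
      go 2 v∈S 2≤dv max with heavyNeighbourOrSparse v∈S 1 1 max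
      ... | inj₁ (u , u∈S , vu , 2≤du) =
          heavyEdge v∈S u∈S vu (≤-trans hN (+-monoʳ-≤ 5 (+-mono-≤ 2≤dv 2≤du)))
      ... | inj₂ sparse₂ = heavyEdgeAt v∈S (≤-trans (m+m≤n⇒m≤⌊n/2⌋ sparse₂) (+-monoʳ-≤ 5 2≤dv))
      go 1 v∈S 1≤dv max = heavyEdgeAt v∈S (≤-trans (m+m≤n⇒m≤⌊n/2⌋ (sparse max)) (+-monoʳ-≤ 5 1≤dv))
      go 0 _ _ max = heavyEdgeAnywhere (≤-trans (m+m≤n⇒m≤⌊n/2⌋ (sparse max)) z≤n)

    heavyEdge₁₅₊ : ∀ m → length S ≡ 3 * (5 + m) → coEdges S ≤ budget (5 + m) → HeavyEdge S (budget (4 + m))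
    heavyEdge₁₅₊ m |S| hN = byMaxCoDegree go
      where
      open Dense unique |S| (≤budget⇒roomy (4 + m) hN)
      t : ℕ
      t = budget (4 + m)
      hN′ : coEdges S ≤ t + 3
      hN′ = subst (coEdges S ≤_) (budget-step m) hN
      go : ∀ {v} D → v ∈ S → D ≤ coDegree S v → MaxCoDegree S D → HeavyEdge S t
      go (suc (suc (suc _))) v∈S D≤dv _ =
          heavyEdgeAt v∈S (≤-trans hN′ (+-monoʳ-≤ t (≤-trans (m≤m+n 3 _) D≤dv)))
      go 2 v∈S 2≤dv max with heavyNeighbourOrSparse v∈S 0 2 max
      ... | inj₁ (u , u∈S , vu , 1≤du) =
          heavyEdge v∈S u∈S vu (≤-trans hN′ (+-monoʳ-≤ t (+-mono-≤ 2≤dv 1≤du)))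
      ... | inj₂ sparse₂ = heavyEdgeAnywhere (≤-trans (m+m≤n⇒m≤⌊n/2⌋ sparse₂) (m≤m+n 3 (6 + 3 * m)))
      go 1 _ _ max = heavyEdgeAnywhere (m+m≤n+n⇒m≤n (≤-trans (sparse max) (budget-double m)))
      go 0 _ _ max = heavyEdgeAnywhere (≤-trans (m+m≤n⇒m≤⌊n/2⌋ (sparse max)) z≤n)

  heavyEdgeExists : ∀ k {S} → Unique S → length S ≡ 3 * suc k → coEdges S ≤ budget (suc k) → HeavyEdge S (budget k)
  heavyEdgeExists 0 unique |S| hN = Dense.heavyEdgeAnywhere unique |S| (≤budget⇒roomy 0 hN) hN
  heavyEdgeExists 1 unique = heavyEdge₆ unique
  heavyEdgeExists 2 unique = heavyEdge₉ unique
  heavyEdgeExists 3 unique = heavyEdge₁₂ unique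
  heavyEdgeExists (suc (suc (suc (suc m)))) unique = heavyEdge₁₅₊ unique m

  record Packing (S : List V) (k : ℕ) : Set where
    field
      corner    : Fin k → Fin 3 → V
      injective : ∀ a b c d → corner a c ≡ corner b d → a ≡ b × c ≡ d
      adjacent  : ∀ a c d → c ≢ d → Adj G (corner a c) (corner a d)
      inside    : ∀ a c → corner a c ∈ S

  emptyPacking : ∀ {S} → Packing S 0
  emptyPacking = record { corner = λ () ; injective = λ () ; adjacent = λ () ; inside = λ () }

  clique-injective : ∀ {m} (τ : Fin m → V) → (∀ c d → c ≢ d → Adj G (τ c) (τ d)) →
                     ∀ c d → τ c ≡ τ d → c ≡ d
  clique-injective τ clique c d τc≡τd with c ≟ᶠ d
  ... | yes c≡d = c≡d
  ... | no c≢d = contradiction τc≡τd (adj⇒≢ (clique c d c≢d))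

  triangle : V → V → V → Fin 3 → V
  triangle v u w fzero = v
  triangle v u w (fsuc fzero) = u
  triangle v u w (fsuc (fsuc fzero)) = w

  triangle-adjacent : ∀ {v u w} → Adj G v u → Adj G v w → Adj G u w →
                      ∀ c d → c ≢ d → Adj G (triangle v u w c) (triangle v u w d)
  triangle-adjacent vu vw uw fzero fzero c≢d = contradiction refl c≢d
  triangle-adjacent vu vw uw fzero (fsuc fzero) _ = vu
  triangle-adjacent vu vw uw fzero (fsuc (fsuc fzero)) _ = vw
  triangle-adjacent vu vw uw (fsuc fzero) fzero _ = adj-sym G vu
  triangle-adjacent vu vw uw (fsuc fzero) (fsuc fzero) c≢d = contradiction refl c≢d
  triangle-adjacent vu vw uw (fsuc fzero) (fsuc (fsuc fzero)) _ = uw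
  triangle-adjacent vu vw uw (fsuc (fsuc fzero)) fzero _ = adj-sym G vw
  triangle-adjacent vu vw uw (fsuc (fsuc fzero)) (fsuc fzero) _ = adj-sym G uw
  triangle-adjacent vu vw uw (fsuc (fsuc fzero)) (fsuc (fsuc fzero)) c≢d = contradiction refl c≢d

  extend : ∀ {S v u w R k} → Adj G v u → Adj G v w → Adj G u w → S ↭ v ∷ u ∷ w ∷ R → Unique S →
           Packing R k → Packing S (suc k)
  extend {S} {v} {u} {w} {R} {k} vu vw uw S↭vuwR unique P =
    record { corner = corner ; injective = injective ; adjacent = adjacent ; inside = inside }
    where
    module P = Packing P
    τ : Fin 3 → V
    τ = triangle v u w
    τ-adjacent : ∀ c d → c ≢ d → Adj G (τ c) (τ d)
    τ-adjacent = triangle-adjacent vu vw uw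

    τ-fresh : ∀ c {y} → y ∈ R → τ c ≢ y
    τ-fresh c y∈R with unique-↭ S↭vuwR unique
    τ-fresh fzero y∈R | v∉ ∷ _ = All.lookup v∉ (there (there y∈R))
    τ-fresh (fsuc fzero) y∈R | _ ∷ u∉ ∷ _ = All.lookup u∉ (there y∈R)
    τ-fresh (fsuc (fsuc fzero)) y∈R | _ ∷ _ ∷ w∉ ∷ _ = All.lookup w∉ y∈R

    τ∈ : ∀ c → τ c ∈ v ∷ u ∷ w ∷ R
    τ∈ fzero = here refl
    τ∈ (fsuc fzero) = there (here refl)
    τ∈ (fsuc (fsuc fzero)) = there (there (here refl))

    corner : Fin (suc k) → Fin 3 → V
    corner fzero = τ
    corner (fsuc a) = P.corner a

    injective : ∀ a b c d → corner a c ≡ corner b d → a ≡ b × c ≡ d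
    injective fzero fzero c d τc≡τd = refl , clique-injective τ τ-adjacent c d τc≡τd
    injective fzero (fsuc b) c d τc≡y = contradiction τc≡y (τ-fresh c (P.inside b d))
    injective (fsuc a) fzero c d y≡τd = contradiction (sym y≡τd) (τ-fresh d (P.inside a c))
    injective (fsuc a) (fsuc b) c d eq with P.injective a b c d eq
    ... | refl , c≡d = refl , c≡d

    adjacent : ∀ a c d → c ≢ d → Adj G (corner a c) (corner a d)
    adjacent fzero = τ-adjacent
    adjacent (fsuc a) = P.adjacent a

    inside : ∀ a c → corner a c ∈ S
    inside fzero c = ∈-resp-↭ (↭-sym S↭vuwR) (τ∈ c)
    inside (fsuc a) c = ∈-resp-↭ (↭-sym S↭vuwR) (there (there (there (P.inside a c))))

  packing : ∀ k {S} → Unique S → length S ≡ 3 * k → coEdges S ≤ budget k → Packing S k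
  packing zero _ _ _ = emptyPacking
  packing (suc k) {S} unique |S| hN
    with heavyEdge {v} {u} v∈S u∈S vu heavy ← heavyEdgeExists k unique |S| hN
    with w , w∈S , vw , uw ← Dense.commonNeighbour unique |S| (≤budget⇒roomy k hN) v∈S u∈S vu
    with R , S↭vuwR ← extract₃ v∈S u∈S w∈S (adj⇒≢ vu) (adj⇒≢ vw) (adj⇒≢ uw)
    with _ ∷ _ ∷ _ ∷ uniqueR ← unique-↭ S↭vuwR unique
    = extend vu vw uw S↭vuwR unique (packing k uniqueR |R| coEdgesR≤budget)
    where
    |R| : length R ≡ 3 * k
    |R| = +-cancelˡ-≡ 3 _ _ (trans (sym (↭-length S↭vuwR)) (trans |S| (*-suc 3 k)))
    coEdgesR≤budget : coEdges R ≤ budget k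
    coEdgesR≤budget = +-cancelʳ-≤ (coDegree S v + coDegree S u) (coEdges R) (budget k) (begin
      coEdges R + (coDegree S v + coDegree S u)         ≤⟨ +-monoˡ-≤ _ (m≤n+m (coEdges R) (coDegree R w)) ⟩
      coEdges (w ∷ R) + (coDegree S v + coDegree S u)   ≡⟨ +-comm (coEdges (w ∷ R)) _ ⟩
      (coDegree S v + coDegree S u) + coEdges (w ∷ R)   ≡⟨ coEdges-split S↭vuwR vu ⟨
      coEdges S                                         ≤⟨ heavy ⟩
      budget k + (coDegree S v + coDegree S u)          ∎)
      where open ≤-Reasoning

coEdges+3≤order : ∀ {n} (G : Graph n) → (n ∸ 1) C 2 + 2 ≤ e G → coEdges G (allFin n) + 3 ≤ n
coEdges+3≤order {zero} G ()
coEdges+3≤order {suc m} G dense = subst (_≤ suc m) (sym (+-suc N 2)) (s≤s (+-cancelˡ-≤ (m C 2) (N + 2) m (begin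
  m C 2 + (N + 2)   ≡⟨ cong (m C 2 +_) (+-comm N 2) ⟩
  m C 2 + (2 + N)   ≡⟨ +-assoc (m C 2) 2 N ⟨
  (m C 2 + 2) + N   ≤⟨ +-monoˡ-≤ N dense ⟩
  e G + N           ≡⟨ e+coEdges≡C2 G ⟩
  suc m C 2         ≡⟨ n+nC2≡[1+n]C2 m ⟨
  m + m C 2         ≡⟨ +-comm m (m C 2) ⟩
  m C 2 + m         ∎)))
  where
  open ≤-Reasoning
  N : ℕ
  N = coEdges G (allFin (suc m))

lemma2p1 : (k : ℕ) → 4 ≤ k → (G : Graph (3 * k)) →
    ((3 * k ∸ 1) C 2) + 2 ≤ e G → HasDisjointTriangles G k
lemma2p1 k@(suc (suc (suc (suc m)))) (s≤s (s≤s (s≤s (s≤s z≤n)))) G dense = corner , injective , adjacent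
  where
  N : ℕ
  N = coEdges G (allFin (3 * k))
  coEdges≤budget : N ≤ budget k
  coEdges≤budget = +-cancelʳ-≤ 3 N (budget k) (subst (N + 3 ≤_) (sym (budget-tight m)) (coEdges+3≤order G dense))
  open Packing (packing G k (allFin⁺ (3 * k)) (length-tabulate id) coEdges≤budget)
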